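{- Let $N\in\mathbf{Mod}_{G,\xi}$ be divisible ($N=\ell N$) and $Y\subseteq X$. Then the projection $N(\overline Y)\to N(Y)$ restricts to an isomorphism $N_{\mathscr P(S),|S|}(\overline Y)\xrightarrow{\sim}N_{\mathscr P(S),|S|}(Y)$, where $\mathscr P(S)$ is the power set of $S$.
   Context: Fix a prime $\ell$, $k_0\ge1$, $\mathbb Z_\ell[\xi]=\mathbb Z_\ell[x]/(1+x^{\ell^{k_0-1}}+\dots+x^{(\ell-1)\ell^{k_0-1}})$, $\omega=\xi-1$. $G$ is a topological group; $\mathbf{Mod}_{G,\xi}$: discrete $\mathbb Z_\ell[\xi]$-modules with continuous $G$-action commuting with $\xi$. For continuous $\chi:G\to\langle\xi\rangle$, the twist $N^\chi$ has a $\mathbb Z_\ell[\xi]$-isomorphism $\beta_\chi:N^\chi\to N$ with $\beta_\chi(\sigma n)=\chi(\sigma)\sigma\beta_\chi(n)$. $S$ nonempty finite, $X_s$ disjoint nonempty finite sets, $X=\prod_sX_s$, projections $\pi_s$; fix $\chi_0$ and $\chi_s:X_s\to\mathrm{Hom}_{\mathrm{cont}}(G,\langle\xi\rangle)$, $\chi(x)=\chi_0\prod_s\chi_s(\pi_s(x))$, $\beta_x=\beta_{\chi(x)}$. $N(Y)=\bigoplus_{x\in Y}N^{\chi(x)}$, $\beta:N(Y)\to N^Y$ componentwise $\beta_x$; $a\cdot m=\sum_xa(x)m(x)$. An $s$-line is $X_s\times\prod_{t\ne s}\{x_{0t}\}$; $\mathrm{zs}(U,Y)$ = functions $a:Y\to\mathbb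 Z_\ell[\xi]$ summing to zero on $L\cap Y$ for each $s$-line $L$ with $s\in U$; $\mathrm{zs}(Y)=\mathrm{zs}(S,Y)$; functions on subsets extend by zero. For an ideal $I$ of subsets and $b$ as usual, $\mathrm{zs}_{I,b}(Y)=(\sum_{U\in I}\omega^{b-|U|}\mathrm{zs}(U,X))\cap\mathbb Z_\ell[\xi]^Y$ and $N_{I,b}(Y)=\{n\in N(Y):a\cdot\beta(n)=0\ \forall a\in\mathrm{zs}_{I,b}(Y)\}$. The closure $\overline Y$ is the maximal $Y\subseteq\overline Y\subseteq X$ for which $\mathbb Z_\ell[\xi]^Y/\mathrm{zs}(Y)\to\mathbb Z_\ell[\xi]^{\overline Y}/\mathrm{zs}(\overline Y)$ is surjective. -}

module Defs where

open import Level using (Level; _⊔_) renaming (suc to lsuc; zero to lzero)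
open import Data.Nat using (ℕ; zero; suc; _+_; _*_; _∸_; _^_; _≤_; _<_; NonZero)
open import Data.Nat.Properties using (m^n≢0)
open import Data.Nat.DivMod using (_mod_; _div_)
open import Data.Nat.Divisibility using (_∣?_)
open import Data.Fin using (Fin; toℕ) renaming (zero to fzero; suc to fsuc)
import Data.Fin as F
open import Data.Bool using (Bool; true; false; if_then_else_; _∧_)
open import Data.List using (List; []; _∷_; foldr; concatMap; map; allFin)
open import Data.Product using (Σ; _×_; _,_; ∃)
open import Data.Unit using (⊤; tt)
open import Relation.Nullary using (does)
open import Relation.Binary.PropositionalEquality using (_≡_)
open import Algebra.Bundles using (Group; AbelianGroup)

-- The finite index data: S = Fin nS, X_s = Fin (sz s),
-- X = ∏_s X_s (encoded first-order as an iterated product).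

Point : (n : ℕ) → (Fin n → ℕ) → Set
Point zero    sz = ⊤
Point (suc n) sz = Fin (sz fzero) × Point n (λ s → sz (fsuc s))

coord : ∀ {n sz} → Point n sz → (s : Fin n) → Fin (sz s)
coord {suc n} (i , _) fzero    = i
coord {suc n} (_ , p) (fsuc s) = coord p s

allPoints : (n : ℕ) (sz : Fin n → ℕ) → List (Point n sz)
allPoints zero    sz = tt ∷ []
allPoints (suc n) sz =
  concatMap (λ i → map (λ p → (i , p)) (allPoints n (λ s → sz (fsuc s))))
            (allFin (sz fzero))

-- sameExcept s x0 x = true iff x t = x0 t for all t ≠ s,
-- i.e. x lies on the s-line through x0.
sameExcept : ∀ {n sz} → Fin n → Point n sz → Point n sz → Bool
sameExcept {zero} () _ _
sameExcept {suc n} {sz} fzero (_ , p) (_ , q) = allEq p q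
  where
  allEq : ∀ {m sz'} → Point m sz' → Point m sz' → Bool
  allEq {zero} _ _ = true
  allEq {suc m} (i , p') (j , q') = does (i F.≟ j) ∧ allEq p' q'
sameExcept {suc n} (fsuc s) (i , p) (j , q) = does (i F.≟ j) ∧ sameExcept s p q

allSubsets : (n : ℕ) → List (Fin n → Bool)
allSubsets zero    = (λ ()) ∷ []
allSubsets (suc n) =
  concatMap (λ b → map (λ U → cons b U) (allSubsets n)) (true ∷ false ∷ [])
  where
  cons : Bool → (Fin n → Bool) → Fin (suc n) → Bool
  cons b U fzero    = b
  cons b U (fsuc s) = U s

card : ∀ {n} → (Fin n → Bool) → ℕ
card {zero}  U = 0
card {suc n} U = (if U fzero then 1 else 0) + card (λ s → U (fsuc s))

-- ℓ-adic integers ℤ_ℓ as ℓ-adic digit expansions (canonical, unique).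

module Coeffs (ℓ : ℕ) .{{nzℓ : NonZero ℓ}} (k0 : ℕ) where

  infix  4 _≈ℓ_ _≈ξ_
  infixl 6 _+ℓ_ _+ξ_ _-ξ_
  infixl 7 _*ℓ_ _*ξ_
  infix  8 -ℓ_ -ξ_
  infix  9 ξ^_ ω^_

  ℤℓ : Set
  ℤℓ = ℕ → Fin ℓ

  _≈ℓ_ : ℤℓ → ℤℓ → Set
  x ≈ℓ y = ∀ k → x k ≡ y k

  val : ℕ → ℤℓ → ℕ
  val zero    x = 0
  val (suc k) x = val k x + toℕ (x k) * ℓ ^ k

  digitOf : ℕ → ℕ → Fin ℓ
  digitOf k m = (_div_ m (ℓ ^ k) {{m^n≢0 ℓ k}}) mod ℓ

  fromℕℓ : ℕ → ℤℓ
  fromℕℓ n k = digitOf k n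

  0ℓ 1ℓ : ℤℓ
  0ℓ = fromℕℓ 0
  1ℓ = fromℕℓ 1

  _+ℓ_ _*ℓ_ : ℤℓ → ℤℓ → ℤℓ
  (x +ℓ y) k = digitOf k (val (suc k) x + val (suc k) y)
  (x *ℓ y) k = digitOf k (val (suc k) x * val (suc k) y)

  -ℓ_ : ℤℓ → ℤℓ
  (-ℓ x) k = digitOf k (ℓ ^ suc k ∸ val (suc k) x)

  -- ℤ_ℓ[ξ] = ℤ_ℓ[x]/(Φ), Φ = 1 + x^m + … + x^{(ℓ-1)m}, m = ℓ^(k0-1),
  -- represented by coordinates in the ℤ_ℓ-basis 1, ξ, …, ξ^(d-1),
  -- d = (ℓ-1)m (only indices i < d are meaningful).

  m : ℕ
  m = ℓ ^ (k0 ∸ 1)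

  d : ℕ
  d = (ℓ ∸ 1) * m

  Rξ : Set
  Rξ = ℕ → ℤℓ

  _≈ξ_ : Rξ → Rξ → Set
  a ≈ξ b = ∀ i → i < d → a i ≈ℓ b i

  0ξ 1ξ : Rξ
  0ξ i = 0ℓ
  1ξ zero    = 1ℓ
  1ξ (suc i) = 0ℓ

  _+ξ_ : Rξ → Rξ → Rξ
  (a +ξ b) i = a i +ℓ b i

  -ξ_ : Rξ → Rξ
  (-ξ a) i = -ℓ (a i)

  _-ξ_ : Rξ → Rξ → Rξ
  a -ξ b = a +ξ (-ξ b)

  scale : ℤℓ → Rξ → Rξ
  scale r a i = r *ℓ a i

  -- multiplication by ξ, using ξ^d = -(1 + ξ^m + … + ξ^{(ℓ-2)m})
  mulξ : Rξ → Rξ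
  mulξ c i = shift i +ℓ (if does (m ∣? i) then -ℓ (c (d ∸ 1)) else 0ℓ)
    where
    shift : ℕ → ℤℓ
    shift zero    = 0ℓ
    shift (suc j) = c j

  mulξ^ : ℕ → Rξ → Rξ
  mulξ^ zero    c = c
  mulξ^ (suc k) c = mulξ (mulξ^ k c)

  sumξ : ℕ → (ℕ → Rξ) → Rξ
  sumξ zero    f = 0ξ
  sumξ (suc n) f = sumξ n f +ξ f n

  _*ξ_ : Rξ → Rξ → Rξ
  a *ξ b = sumξ d (λ i → scale (a i) (mulξ^ i b))

  ξ : Rξ
  ξ = mulξ 1ξ

  ξ^_ : ℕ → Rξ
  ξ^ k = mulξ^ k 1ξ

  ω : Rξ
  ω = ξ -ξ 1ξ

  ω^_ : ℕ → Rξ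
  ω^ zero    = 1ξ
  ω^ (suc k) = ω *ξ (ω^ k)

  ι : ℕ → Rξ
  ι n zero    = fromℕℓ n
  ι n (suc i) = 0ℓ

  sumList : {A : Set} → List A → (A → Rξ) → Rξ
  sumList xs f = foldr (λ x acc → f x +ξ acc) 0ξ xs

  -- Objects of Mod_{G,ξ}: a discrete ℤ_ℓ[ξ]-module with G-action
  -- commuting with ℤ_ℓ[ξ].  (Continuity of the G-action is not
  -- expressible.)

  record ModGξ {g h c r : Level} (G : Group g h) (A : AbelianGroup c r)
         : Set (g ⊔ h ⊔ c ⊔ r) where
    private
      module G = Group G
      module A = AbelianGroup A
    infixr 8 _•_
    field
      _•_        : Rξ → A.Carrier → A.Carrier
      •-cong     : ∀ {a b x y} → a ≈ξ b → x A.≈ y → (a • x) A.≈ (b • y)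
      •-distribˡ : ∀ a x y → (a • (x A.∙ y)) A.≈ ((a • x) A.∙ (a • y))
      •-distribʳ : ∀ a b x → ((a +ξ b) • x) A.≈ ((a • x) A.∙ (b • x))
      •-assoc    : ∀ a b x → ((a *ξ b) • x) A.≈ (a • (b • x))
      •-identity : ∀ x → (1ξ • x) A.≈ x
      discrete   : ∀ x → ∃ λ k → (ι (ℓ ^ k) • x) A.≈ A.ε
      act        : G.Carrier → A.Carrier → A.Carrier
      act-cong   : ∀ {σ τ x y} → σ G.≈ τ → x A.≈ y → act σ x A.≈ act τ y
      act-ε      : ∀ x → act G.ε x A.≈ x
      act-∙      : ∀ σ τ x → act (σ G.∙ τ) x A.≈ act σ (act τ x)
      act-hom    : ∀ σ x y → act σ (x A.∙ y) A.≈ (act σ x A.∙ act σ y)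
      act-lin    : ∀ σ a x → act σ (a • x) A.≈ (a • act σ x)

  -- characters G → ⟨ξ⟩ (continuity not expressible)
  record Char {g h : Level} (G : Group g h) : Set (g ⊔ h) where
    private module G = Group G
    field
      χ      : G.Carrier → Rξ
      χ-cong : ∀ {σ τ} → σ G.≈ τ → χ σ ≈ξ χ τ
      χ-hom  : ∀ σ τ → χ (σ G.∙ τ) ≈ξ (χ σ *ξ χ τ)
      χ-root : ∀ σ → ∃ λ k → χ σ ≈ξ (ξ^ k)

  Divisible : ∀ {g h c r} {G : Group g h} {A : AbelianGroup c r} →
              ModGξ G A → Set (c ⊔ r)
  Divisible {A = A} M = ∀ x → ∃ λ y → (ι ℓ • y) A.≈ x
    where
    module A = AbelianGroup A
    open ModGξ M

  module Grid (nS : ℕ) (sz : Fin nS → ℕ) where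

    X : Set
    X = Point nS sz

    -- subsets of X (finite, hence decidable)
    SubX : Set
    SubX = X → Bool

    _⊆_ : SubX → SubX → Set
    Y ⊆ Z = ∀ x → Y x ≡ true → Z x ≡ true

    full : Fin nS → Bool
    full _ = true

    -- a : X → ℤ_ℓ[ξ] is an element of ℤ_ℓ[ξ]^Y (extended by zero)
    Supp : SubX → (X → Rξ) → Set
    Supp Y a = ∀ x → Y x ≡ false → a x ≈ξ 0ξ

    lineSum : Fin nS → X → (X → Rξ) → Rξ
    lineSum s x0 a = sumList (allPoints nS sz)
                       (λ x → if sameExcept s x0 x then a x else 0ξ)

    zs : (Fin nS → Bool) → SubX → (X → Rξ) → Set
    zs U Y a = Supp Y a ×
               (∀ s → U s ≡ true → ∀ x0 → lineSum s x0 a ≈ξ 0ξ)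

    -- zs_{I,b}(Y) = (Σ_{U∈I} ω^{b-|U|} zs(U,X)) ∩ ℤ_ℓ[ξ]^Y
    zsIb : ((Fin nS → Bool) → Bool) → ℕ → SubX → (X → Rξ) → Set
    zsIb I b Y a =
      Supp Y a ×
      Σ ((Fin nS → Bool) → X → Rξ) λ c →
        (∀ U → I U ≡ true → zs U (λ _ → true) (c U)) ×
        (∀ x → a x ≈ξ sumList (allSubsets nS)
                        (λ U → if I U then (ω^ (b ∸ card U)) *ξ c U x
                                      else 0ξ))

    -- surjectivity of ℤ_ℓ[ξ]^Y/zs(Y) → ℤ_ℓ[ξ]^Z/zs(Z)
    SurjQ : SubX → SubX → Set
    SurjQ Y Z = ∀ b → Supp Z b →
                ∃ λ a → Supp Y a × zs full Z (λ x → b x -ξ a x)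

    IsClosure : SubX → SubX → Set
    IsClosure Y Ybar = Y ⊆ Ybar × SurjQ Y Ybar ×
                       (∀ Z → Y ⊆ Z → SurjQ Y Z → Z ⊆ Ybar)

    𝒫S : (Fin nS → Bool) → Bool
    𝒫S _ = true

    module OverN {g h c r : Level} {G : Group g h} {A : AbelianGroup c r}
                 (M : ModGξ G A) where
      private module A = AbelianGroup A
      open ModGξ M

      -- elements of N(Y) = ⊕_{x∈Y} N^{χ(x)}, stored via β as X → N
      -- supported on Y
      SuppN : SubX → (X → A.Carrier) → Set r
      SuppN Y n = ∀ x → Y x ≡ false → n x A.≈ A.ε

      dot : (X → Rξ) → (X → A.Carrier) → A.Carrier
      dot a n = foldr (λ x acc → (a x • n x) A.∙ acc) A.ε (allPoints nS sz)

      NIb : ((Fin nS → Bool) → Bool) → ℕ → SubX → (X → A.Carrier) → Set r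
      NIb I b Y n = SuppN Y n × (∀ a → zsIb I b Y a → dot a n A.≈ A.ε)

      proj : SubX → (X → A.Carrier) → X → A.Carrier
      proj Y n x = if Y x then n x else A.ε

      ProjBij : (P Q : (X → A.Carrier) → Set r) → SubX → Set (c ⊔ r)
      ProjBij P Q Y =
        (∀ n → P n → Q (proj Y n)) ×
        (∀ n n' → P n → P n' → (∀ x → proj Y n x A.≈ proj Y n' x) →
                  ∀ x → n x A.≈ n' x) ×
        (∀ n → Q n → ∃ λ n' → P n' × (∀ x → proj Y n' x A.≈ n x))

{-# OPTIONS --safe #-}
module Submission where

open import Defs
open import Level using (Level)
open import Data.Nat
open import Data.Nat.Properties
open import Data.Nat.DivMod
open import Data.Nat.Divisibility using (_∣_; _∣?_; divides; n∣m*n; ∣-trans; m%n≡0⇒n∣m; n∣m⇒m%n≡0)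
open import Data.Nat.Primality using (Prime)
open import Data.Fin using (Fin; toℕ) renaming (zero to fzero; suc to fsuc)
import Data.Fin.Properties as Fin
open import Data.Bool using (Bool; true; false; if_then_else_; T)
open import Data.List using (List; []; _∷_; foldr; _++_; map; concatMap; allFin)
open import Data.List.Properties using (map-tabulate)
open import Data.Product using (Σ; _×_; _,_; proj₁; proj₂; ∃)
open import Data.Product.Properties using (≡-dec)
open import Data.Sum using (_⊎_; inj₁; inj₂)
open import Data.Empty using (⊥-elim)
open import Function using (_∘_)
open import Relation.Binary using (Setoid; tri<; tri≈; tri>)
open import Relation.Binary.Definitions using (DecidableEquality)
open import Relation.Binary.PropositionalEquality as ≡ using (_≡_; _≢_)
open import Relation.Nullary using (does; yes)
open import Relation.Nullary.Decidable using (dec-true; dec-false)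
import Relation.Binary.Construct.On as On
import Relation.Binary.Reasoning.Setoid as SetoidReasoning
open import Algebra.Bundles using (Group; AbelianGroup)
import Algebra.Properties.Group as GroupProperties
import Algebra.Properties.AbelianGroup as AbelianGroupProperties
import Algebra.Properties.CommutativeSemigroup as CommutativeSemigroupProperties

-- Since S ∈ 𝒫(S) enters zs_{𝒫(S),|S|} with weight ω^0 = 1, we have zs(Z) ⊆ zs_{𝒫(S),|S|}(Z), so every
-- n ∈ N_{𝒫(S),|S|}(Z) satisfies e · n = a · n whenever e ≡ a modulo zs(Z).  By the defining property of
-- the closure, δ_z (restricted to Ybar) is congruent modulo zs(Ybar) to some a_z supported on Y.  Hence
-- n(z) = a_z · n for every n ∈ N_{𝒫(S),|S|}(Ybar), so the projection is injective; and z ↦ a_z · n extends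
-- n ∈ N_{𝒫(S),|S|}(Y), because for b ∈ zs_{𝒫(S),|S|}(Ybar) one has b · ext(n) = b' · n with
-- b' = Σ_z b(z) a_z, and b' ≡ b modulo zs(X) lies in zs_{𝒫(S),|S|}(Y).

module _ (n : ℕ) .{{_ : NonZero n}} where
  open ≡ using (refl; cong; cong₂)

  %-cong-+ : ∀ {a a' b b'} → a % n ≡ a' % n → b % n ≡ b' % n → (a + b) % n ≡ (a' + b') % n
  %-cong-+ {a} {a'} {b} {b'} p q = begin
    (a + b) % n             ≡⟨ %-distribˡ-+ a b n ⟩
    (a % n + b % n) % n     ≡⟨ cong₂ (λ u v → (u + v) % n) p q ⟩
    (a' % n + b' % n) % n   ≡⟨ %-distribˡ-+ a' b' n ⟨
    (a' + b') % n           ∎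
    where open ≡.≡-Reasoning

  %-cong-* : ∀ {a a' b b'} → a % n ≡ a' % n → b % n ≡ b' % n → (a * b) % n ≡ (a' * b') % n
  %-cong-* {a} {a'} {b} {b'} p q = begin
    (a * b) % n             ≡⟨ %-distribˡ-* a b n ⟩
    (a % n * (b % n)) % n   ≡⟨ cong₂ (λ u v → (u * v) % n) p q ⟩
    (a' % n * (b' % n)) % n ≡⟨ %-distribˡ-* a' b' n ⟨
    (a' * b') % n           ∎
    where open ≡.≡-Reasoning

  %-cancelʳ-+ : ∀ a b v → (a + v) % n ≡ (b + v) % n → a % n ≡ b % n
  %-cancelʳ-+ a b v eq = begin
    a % n               ≡⟨ %-remove-+ʳ a n∣v+w ⟨
    (a + (v + w)) % n   ≡⟨ cong (_% n) (+-assoc a v w) ⟨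
    (a + v + w) % n     ≡⟨ %-cong-+ eq refl ⟩
    (b + v + w) % n     ≡⟨ cong (_% n) (+-assoc b v w) ⟩
    (b + (v + w)) % n   ≡⟨ %-remove-+ʳ b n∣v+w ⟩
    b % n               ∎
    where
    open ≡.≡-Reasoning
    w = n ∸ v % n
    n∣v+w : n ∣ v + w
    n∣v+w = m%n≡0⇒n∣m (v + w) n (begin
      (v + w) % n       ≡⟨ %-cong-+ (m%n%n≡m%n v n) refl ⟨
      (v % n + w) % n   ≡⟨ cong (_% n) (m+[n∸m]≡n (m%n≤n v n)) ⟩
      n % n             ≡⟨ n%n≡0 n ⟩
      0                 ∎)

-- Identities in ℤ_ℓ are checked on the truncations val k, modulo ℓ^k for every k (≈ℓ-from-val).
module ℤℓ-Properties (ℓ : ℕ) .{{_ : NonZero ℓ}} (k0 : ℕ) where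
  open Coeffs ℓ k0
  open ≡ using (refl; sym; trans; cong; cong₂; subst)

  private
    ℓ^≢0 : ∀ k → NonZero (ℓ ^ k)
    ℓ^≢0 k = m^n≢0 ℓ k

  infixl 7 _%ℓ^_ _/ℓ^_
  _%ℓ^_ _/ℓ^_ : ℕ → ℕ → ℕ
  a %ℓ^ k = _%_ a (ℓ ^ k) {{ℓ^≢0 k}}
  a /ℓ^ k = _/_ a (ℓ ^ k) {{ℓ^≢0 k}}

  val<ℓ^ : ∀ k x → val k x < ℓ ^ k
  val<ℓ^ zero    x = s≤s z≤n
  val<ℓ^ (suc k) x = begin-strict
    val k x + toℕ (x k) * ℓ ^ k   <⟨ +-monoˡ-< (toℕ (x k) * ℓ ^ k) (val<ℓ^ k x) ⟩
    suc (toℕ (x k)) * ℓ ^ k       ≤⟨ *-monoˡ-≤ (ℓ ^ k) (Fin.toℕ<n (x k)) ⟩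
    ℓ * ℓ ^ k                     ∎
    where open ≤-Reasoning

  val-%ℓ^ : ∀ x {j k} → j ≤ k → val k x %ℓ^ j ≡ val j x
  val-%ℓ^ x {j} j≤k = subst (λ k → val k x %ℓ^ j ≡ val j x) (m∸n+n≡m j≤k) (go (_ ∸ j))
    where
    go : ∀ i → val (i + j) x %ℓ^ j ≡ val j x
    go zero    = m<n⇒m%n≡m {{ℓ^≢0 j}} (val<ℓ^ j x)
    go (suc i) = trans (%-remove-+ʳ (val (i + j) x) {{ℓ^≢0 j}} ℓ^j∣) (go i)
      where
      ℓ^j∣ : ℓ ^ j ∣ toℕ (x (i + j)) * ℓ ^ (i + j)
      ℓ^j∣ = ∣-trans (divides (ℓ ^ i) (^-distribˡ-+-* ℓ i j)) (n∣m*n (toℕ (x (i + j))))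

  val-digits : ∀ k z N → (∀ j → j < k → toℕ (z j) ≡ N /ℓ^ j % ℓ) → val k z ≡ N %ℓ^ k
  val-digits zero    z N _ = sym (n%1≡0 N)
  val-digits (suc k) z N digits = begin
    val k z + toℕ (z k) * ℓ ^ k        ≡⟨ cong₂ (λ a b → a + b * ℓ ^ k) lower-digits (digits k ≤-refl) ⟩
    N %ℓ^ k + (N /ℓ^ k % ℓ) * ℓ ^ k    ≡⟨ cong₂ (λ a b → a + b * ℓ ^ k) M%ℓ^k M/ℓ^k ⟨
    M %ℓ^ k + M /ℓ^ k * ℓ ^ k          ≡⟨ m≡m%n+[m/n]*n M (ℓ ^ k) {{ℓ^≢0 k}} ⟨
    M                                  ∎
    where
    open ≡.≡-Reasoning
    M = N %ℓ^ suc k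
    lower-digits : val k z ≡ N %ℓ^ k
    lower-digits = val-digits k z N (λ j j<k → digits j (m<n⇒m<1+n j<k))
    M%ℓ^k : M %ℓ^ k ≡ N %ℓ^ k
    M%ℓ^k = m∣n⇒o%n%m≡o%m (ℓ ^ k) (ℓ ^ suc k) N {{ℓ^≢0 k}} {{ℓ^≢0 (suc k)}} (n∣m*n ℓ)
    M/ℓ^k : M /ℓ^ k ≡ N /ℓ^ k % ℓ
    M/ℓ^k = m%[n*o]/o≡m/o%n N ℓ (ℓ ^ k) {{_}} {{ℓ^≢0 k}} {{ℓ^≢0 (suc k)}}

  digitOf-cong : ∀ j A B → A %ℓ^ suc j ≡ B %ℓ^ suc j → digitOf j A ≡ digitOf j B
  digitOf-cong j A B eq = Fin.toℕ-injective (begin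
    toℕ (digitOf j A)       ≡⟨ Fin.toℕ-fromℕ< _ ⟩
    A /ℓ^ j % ℓ             ≡⟨ m%[n*o]/o≡m/o%n A ℓ (ℓ ^ j) {{_}} {{ℓ^≢0 j}} {{ℓ^≢0 (suc j)}} ⟨
    A %ℓ^ suc j /ℓ^ j       ≡⟨ cong (_/ℓ^ j) eq ⟩
    B %ℓ^ suc j /ℓ^ j       ≡⟨ m%[n*o]/o≡m/o%n B ℓ (ℓ ^ j) {{_}} {{ℓ^≢0 j}} {{ℓ^≢0 (suc j)}} ⟩
    B /ℓ^ j % ℓ             ≡⟨ Fin.toℕ-fromℕ< _ ⟨
    toℕ (digitOf j B)       ∎)
    where open ≡.≡-Reasoning

  infix 4 _≡[_]_
  _≡[_]_ : ℕ → ℕ → ℕ → Set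
  a ≡[ k ] b = a %ℓ^ k ≡ b %ℓ^ k

  ≡[]-setoid : ℕ → Setoid _ _
  ≡[]-setoid k = On.setoid (≡.setoid ℕ) (_%ℓ^ k)

  module ≡[]-Reasoning (k : ℕ) = SetoidReasoning (≡[]-setoid k)

  +-cong[] : ∀ k {a a' b b'} → a ≡[ k ] a' → b ≡[ k ] b' → a + b ≡[ k ] a' + b'
  +-cong[] k = %-cong-+ (ℓ ^ k) {{ℓ^≢0 k}}

  *-cong[] : ∀ k {a a' b b'} → a ≡[ k ] a' → b ≡[ k ] b' → a * b ≡[ k ] a' * b'
  *-cong[] k = %-cong-* (ℓ ^ k) {{ℓ^≢0 k}}

  -- +ℓ, *ℓ, -ℓ and fromℕℓ all have the shape j ↦ digitOf j (F (suc j)), where F k is a natural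
  -- number computing the result modulo ℓ^k; such a digit sequence is meaningful when F is coherent.
  Coherent : (ℕ → ℕ) → Set
  Coherent F = ∀ {j k} → j < k → F (suc j) %ℓ^ suc j ≡ F k %ℓ^ suc j

  coherent-val : ∀ x → Coherent (λ k → val k x)
  coherent-val x j<k = trans (val-%ℓ^ x ≤-refl) (sym (val-%ℓ^ x j<k))

  coherent-+ : ∀ {F G} → Coherent F → Coherent G → Coherent (λ k → F k + G k)
  coherent-+ cF cG {j} j<k = +-cong[] (suc j) (cF j<k) (cG j<k)

  coherent-* : ∀ {F G} → Coherent F → Coherent G → Coherent (λ k → F k * G k)
  coherent-* cF cG {j} j<k = *-cong[] (suc j) (cF j<k) (cG j<k)

  ℓ^-%ℓ^ : ∀ {j k} → j ≤ k → ℓ ^ k %ℓ^ j ≡ 0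
  ℓ^-%ℓ^ {j} {k} j≤k = n∣m⇒m%n≡0 (ℓ ^ k) (ℓ ^ j) {{ℓ^≢0 j}}
    (divides (ℓ ^ (k ∸ j)) (trans (cong (ℓ ^_) (sym (m∸n+n≡m j≤k))) (^-distribˡ-+-* ℓ (k ∸ j) j)))

  -- ℓ^k ∸ val k x represents -x modulo ℓ^k; the truncated subtraction never truncates since val k x < ℓ^k
  coherent-neg : ∀ x → Coherent (λ k → ℓ ^ k ∸ val k x)
  coherent-neg x {j} {k} j<k = %-cancelʳ-+ (ℓ ^ suc j) {{ℓ^≢0 (suc j)}} _ _ (val (suc j) x) (begin
    (ℓ ^ suc j ∸ val (suc j) x + val (suc j) x) %ℓ^ suc j   ≡⟨ cong (_%ℓ^ suc j) (∸+val (suc j)) ⟩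
    ℓ ^ suc j %ℓ^ suc j                                     ≡⟨ ℓ^-%ℓ^ {suc j} ≤-refl ⟩
    0                                                       ≡⟨ ℓ^-%ℓ^ j<k ⟨
    ℓ ^ k %ℓ^ suc j                                         ≡⟨ cong (_%ℓ^ suc j) (∸+val k) ⟨
    (ℓ ^ k ∸ val k x + val k x) %ℓ^ suc j                   ≡⟨ +-cong[] (suc j) refl (coherent-val x j<k) ⟨
    (ℓ ^ k ∸ val k x + val (suc j) x) %ℓ^ suc j             ∎)
    where
    open ≡.≡-Reasoning
    ∸+val : ∀ i → ℓ ^ i ∸ val i x + val i x ≡ ℓ ^ i
    ∸+val i = m∸n+n≡m (<⇒≤ (val<ℓ^ i x))

  val-coherent : ∀ F → Coherent F → ∀ k → val k (λ j → digitOf j (F (suc j))) ≡[ k ] F k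
  val-coherent F coh k = trans (cong (_%ℓ^ k) val≡) (m%n%n≡m%n (F k) (ℓ ^ k) {{ℓ^≢0 k}})
    where
    val≡ : val k (λ j → digitOf j (F (suc j))) ≡ F k %ℓ^ k
    val≡ = val-digits k _ (F k) λ j j<k → trans (cong toℕ (digitOf-cong j _ _ (coh j<k))) (Fin.toℕ-fromℕ< _)

  val-+ : ∀ k x y → val k (x +ℓ y) ≡[ k ] val k x + val k y
  val-+ k x y = val-coherent _ (coherent-+ (coherent-val x) (coherent-val y)) k

  val-* : ∀ k x y → val k (x *ℓ y) ≡[ k ] val k x * val k y
  val-* k x y = val-coherent _ (coherent-* (coherent-val x) (coherent-val y)) k

  val-neg : ∀ k x → val k (-ℓ x) ≡[ k ] ℓ ^ k ∸ val k x
  val-neg k x = val-coherent _ (coherent-neg x) k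

  val-fromℕℓ : ∀ k n → val k (fromℕℓ n) ≡[ k ] n
  val-fromℕℓ k n = val-coherent (λ _ → n) (λ _ → refl) k

  val-cong : ∀ k {x y} → x ≈ℓ y → val k x ≡ val k y
  val-cong zero    x≈y = refl
  val-cong (suc k) x≈y = cong₂ (λ a b → a + toℕ b * ℓ ^ k) (val-cong k x≈y) (x≈y k)

  ≈ℓ-from-val : ∀ {x y} → (∀ k → val k x ≡[ k ] val k y) → x ≈ℓ y
  ≈ℓ-from-val {x} {y} eq k = Fin.toℕ-injective (*-cancelʳ-≡ _ _ (ℓ ^ k) {{ℓ^≢0 k}}
    (+-cancelˡ-≡ (val k x) _ _ (trans (val≡ (suc k)) (cong (_+ toℕ (y k) * ℓ ^ k) (sym (val≡ k))))))
    where
    val≡ : ∀ k → val k x ≡ val k y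
    val≡ k = trans (sym (m<n⇒m%n≡m {{ℓ^≢0 k}} (val<ℓ^ k x)))
                   (trans (eq k) (m<n⇒m%n≡m {{ℓ^≢0 k}} (val<ℓ^ k y)))

  ≈ℓ-refl : ∀ {x} → x ≈ℓ x
  ≈ℓ-refl k = refl

  ≈ℓ-sym : ∀ {x y} → x ≈ℓ y → y ≈ℓ x
  ≈ℓ-sym x≈y k = sym (x≈y k)

  ≈ℓ-trans : ∀ {x y z} → x ≈ℓ y → y ≈ℓ z → x ≈ℓ z
  ≈ℓ-trans x≈y y≈z k = trans (x≈y k) (y≈z k)

  ≈ℓ-reflexive : ∀ {x y} → x ≡ y → x ≈ℓ y
  ≈ℓ-reflexive refl = ≈ℓ-refl

  +ℓ-cong : ∀ {x x' y y'} → x ≈ℓ x' → y ≈ℓ y' → x +ℓ y ≈ℓ x' +ℓ y'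
  +ℓ-cong {x} {x'} {y} {y'} p q = ≈ℓ-from-val λ k → let open ≡[]-Reasoning k in begin
    val k (x +ℓ y)              ≈⟨ val-+ k x y ⟩
    val k x + val k y           ≡⟨ cong₂ _+_ (val-cong k p) (val-cong k q) ⟩
    val k x' + val k y'         ≈⟨ val-+ k x' y' ⟨
    val k (x' +ℓ y')            ∎

  *ℓ-cong : ∀ {x x' y y'} → x ≈ℓ x' → y ≈ℓ y' → x *ℓ y ≈ℓ x' *ℓ y'
  *ℓ-cong {x} {x'} {y} {y'} p q = ≈ℓ-from-val λ k → let open ≡[]-Reasoning k in begin
    val k (x *ℓ y)              ≈⟨ val-* k x y ⟩
    val k x * val k y           ≡⟨ cong₂ _*_ (val-cong k p) (val-cong k q) ⟩
    val k x' * val k y'         ≈⟨ val-* k x' y' ⟨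
    val k (x' *ℓ y')            ∎

  -ℓ-cong : ∀ {x x'} → x ≈ℓ x' → -ℓ x ≈ℓ -ℓ x'
  -ℓ-cong {x} {x'} p = ≈ℓ-from-val λ k → let open ≡[]-Reasoning k in begin
    val k (-ℓ x)                ≈⟨ val-neg k x ⟩
    ℓ ^ k ∸ val k x             ≡⟨ cong (ℓ ^ k ∸_) (val-cong k p) ⟩
    ℓ ^ k ∸ val k x'            ≈⟨ val-neg k x' ⟨
    val k (-ℓ x')               ∎

  +ℓ-assoc : ∀ x y z → (x +ℓ y) +ℓ z ≈ℓ x +ℓ (y +ℓ z)
  +ℓ-assoc x y z = ≈ℓ-from-val λ k → let open ≡[]-Reasoning k in begin
    val k ((x +ℓ y) +ℓ z)             ≈⟨ val-+ k (x +ℓ y) z ⟩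
    val k (x +ℓ y) + val k z          ≈⟨ +-cong[] k (val-+ k x y) refl ⟩
    val k x + val k y + val k z       ≡⟨ +-assoc (val k x) (val k y) (val k z) ⟩
    val k x + (val k y + val k z)     ≈⟨ +-cong[] k refl (val-+ k y z) ⟨
    val k x + val k (y +ℓ z)          ≈⟨ val-+ k x (y +ℓ z) ⟨
    val k (x +ℓ (y +ℓ z))             ∎

  +ℓ-comm : ∀ x y → x +ℓ y ≈ℓ y +ℓ x
  +ℓ-comm x y = ≈ℓ-from-val λ k → let open ≡[]-Reasoning k in begin
    val k (x +ℓ y)                    ≈⟨ val-+ k x y ⟩
    val k x + val k y                 ≡⟨ +-comm (val k x) (val k y) ⟩
    val k y + val k x                 ≈⟨ val-+ k y x ⟨
    val k (y +ℓ x)                    ∎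

  +ℓ-identityˡ : ∀ x → 0ℓ +ℓ x ≈ℓ x
  +ℓ-identityˡ x = ≈ℓ-from-val λ k → let open ≡[]-Reasoning k in begin
    val k (0ℓ +ℓ x)                   ≈⟨ val-+ k 0ℓ x ⟩
    val k 0ℓ + val k x                ≈⟨ +-cong[] k (val-fromℕℓ k 0) refl ⟩
    val k x                           ∎

  +ℓ-identityʳ : ∀ x → x +ℓ 0ℓ ≈ℓ x
  +ℓ-identityʳ x = ≈ℓ-trans (+ℓ-comm x 0ℓ) (+ℓ-identityˡ x)

  -ℓ-inverseʳ : ∀ x → x +ℓ (-ℓ x) ≈ℓ 0ℓ
  -ℓ-inverseʳ x = ≈ℓ-from-val λ k → let open ≡[]-Reasoning k in begin
    val k (x +ℓ (-ℓ x))               ≈⟨ val-+ k x (-ℓ x) ⟩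
    val k x + val k (-ℓ x)            ≈⟨ +-cong[] k refl (val-neg k x) ⟩
    val k x + (ℓ ^ k ∸ val k x)       ≡⟨ m+[n∸m]≡n (<⇒≤ (val<ℓ^ k x)) ⟩
    ℓ ^ k                             ≈⟨ trans (ℓ^-%ℓ^ {k} ≤-refl) (sym (m<n⇒m%n≡m {{ℓ^≢0 k}} (m^n>0 ℓ k))) ⟩
    0                                 ≈⟨ val-fromℕℓ k 0 ⟨
    val k 0ℓ                          ∎

  -ℓ-inverseˡ : ∀ x → (-ℓ x) +ℓ x ≈ℓ 0ℓ
  -ℓ-inverseˡ x = ≈ℓ-trans (+ℓ-comm (-ℓ x) x) (-ℓ-inverseʳ x)

  *ℓ-distribˡ : ∀ r x y → r *ℓ (x +ℓ y) ≈ℓ (r *ℓ x) +ℓ (r *ℓ y)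
  *ℓ-distribˡ r x y = ≈ℓ-from-val λ k → let open ≡[]-Reasoning k in begin
    val k (r *ℓ (x +ℓ y))                 ≈⟨ val-* k r (x +ℓ y) ⟩
    val k r * val k (x +ℓ y)              ≈⟨ *-cong[] k {val k r} refl (val-+ k x y) ⟩
    val k r * (val k x + val k y)         ≡⟨ *-distribˡ-+ (val k r) (val k x) (val k y) ⟩
    val k r * val k x + val k r * val k y ≈⟨ +-cong[] k (val-* k r x) (val-* k r y) ⟨
    val k (r *ℓ x) + val k (r *ℓ y)       ≈⟨ val-+ k (r *ℓ x) (r *ℓ y) ⟨
    val k ((r *ℓ x) +ℓ (r *ℓ y))          ∎

  *ℓ-distribʳ : ∀ r x y → (x +ℓ y) *ℓ r ≈ℓ (x *ℓ r) +ℓ (y *ℓ r)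
  *ℓ-distribʳ r x y = ≈ℓ-from-val λ k → let open ≡[]-Reasoning k in begin
    val k ((x +ℓ y) *ℓ r)                 ≈⟨ val-* k (x +ℓ y) r ⟩
    val k (x +ℓ y) * val k r              ≈⟨ *-cong[] k (val-+ k x y) refl ⟩
    (val k x + val k y) * val k r         ≡⟨ *-distribʳ-+ (val k r) (val k x) (val k y) ⟩
    val k x * val k r + val k y * val k r ≈⟨ +-cong[] k (val-* k x r) (val-* k y r) ⟨
    val k (x *ℓ r) + val k (y *ℓ r)       ≈⟨ val-+ k (x *ℓ r) (y *ℓ r) ⟨
    val k ((x *ℓ r) +ℓ (y *ℓ r))          ∎

  *ℓ-identityˡ : ∀ x → 1ℓ *ℓ x ≈ℓ x
  *ℓ-identityˡ x = ≈ℓ-from-val λ k → let open ≡[]-Reasoning k in begin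
    val k (1ℓ *ℓ x)                   ≈⟨ val-* k 1ℓ x ⟩
    val k 1ℓ * val k x                ≈⟨ *-cong[] k (val-fromℕℓ k 1) refl ⟩
    1 * val k x                       ≡⟨ *-identityˡ (val k x) ⟩
    val k x                           ∎

  *ℓ-identityʳ : ∀ x → x *ℓ 1ℓ ≈ℓ x
  *ℓ-identityʳ x = ≈ℓ-from-val λ k → let open ≡[]-Reasoning k in begin
    val k (x *ℓ 1ℓ)                   ≈⟨ val-* k x 1ℓ ⟩
    val k x * val k 1ℓ                ≈⟨ *-cong[] k {val k x} refl (val-fromℕℓ k 1) ⟩
    val k x * 1                       ≡⟨ *-identityʳ (val k x) ⟩
    val k x                           ∎

  +ℓ-abelianGroup : AbelianGroup _ _
  +ℓ-abelianGroup = record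
    { Carrier = ℤℓ ; _≈_ = _≈ℓ_ ; _∙_ = _+ℓ_ ; ε = 0ℓ ; _⁻¹ = -ℓ_
    ; isAbelianGroup = record
      { isGroup = record
        { isMonoid = record
          { isSemigroup = record
            { isMagma = record
              { isEquivalence = record { refl = ≈ℓ-refl ; sym = ≈ℓ-sym ; trans = ≈ℓ-trans }
              ; ∙-cong = +ℓ-cong }
            ; assoc = +ℓ-assoc }
          ; identity = +ℓ-identityˡ , +ℓ-identityʳ }
        ; inverse = -ℓ-inverseˡ , -ℓ-inverseʳ
        ; ⁻¹-cong = -ℓ-cong }
      ; comm = +ℓ-comm } }

  private
    module ℤℓ = GroupProperties (AbelianGroup.group +ℓ-abelianGroup)

  *ℓ-zeroˡ : ∀ x → 0ℓ *ℓ x ≈ℓ 0ℓ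
  *ℓ-zeroˡ x = ℤℓ.identityˡ-unique (0ℓ *ℓ x) (0ℓ *ℓ x)
    (≈ℓ-trans (≈ℓ-sym (*ℓ-distribʳ x 0ℓ 0ℓ)) (*ℓ-cong (+ℓ-identityˡ 0ℓ) ≈ℓ-refl))

  *ℓ-zeroʳ : ∀ x → x *ℓ 0ℓ ≈ℓ 0ℓ
  *ℓ-zeroʳ x = ℤℓ.identityˡ-unique (x *ℓ 0ℓ) (x *ℓ 0ℓ)
    (≈ℓ-trans (≈ℓ-sym (*ℓ-distribˡ x 0ℓ 0ℓ)) (*ℓ-cong ≈ℓ-refl (+ℓ-identityˡ 0ℓ)))

module ℤℓ[ξ]-Properties (ℓ : ℕ) .{{_ : NonZero ℓ}} (k0 : ℕ) where
  open Coeffs ℓ k0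
  open ℤℓ-Properties ℓ k0
  open ≡ using (refl; sym; cong)

  +ξ-abelianGroup : AbelianGroup _ _
  +ξ-abelianGroup = record
    { Carrier = Rξ ; _≈_ = _≈ξ_ ; _∙_ = _+ξ_ ; ε = 0ξ ; _⁻¹ = -ξ_
    ; isAbelianGroup = record
      { isGroup = record
        { isMonoid = record
          { isSemigroup = record
            { isMagma = record
              { isEquivalence = record
                { refl = λ _ _ → ≈ℓ-refl
                ; sym = λ p i i<d → ≈ℓ-sym (p i i<d)
                ; trans = λ p q i i<d → ≈ℓ-trans (p i i<d) (q i i<d) }
              ; ∙-cong = λ p q i i<d → +ℓ-cong (p i i<d) (q i i<d) }
            ; assoc = λ a b c i _ → +ℓ-assoc (a i) (b i) (c i) }
          ; identity = (λ a i _ → +ℓ-identityˡ (a i)) , (λ a i _ → +ℓ-identityʳ (a i)) }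
        ; inverse = (λ a i _ → -ℓ-inverseˡ (a i)) , (λ a i _ → -ℓ-inverseʳ (a i))
        ; ⁻¹-cong = λ p i i<d → -ℓ-cong (p i i<d) }
      ; comm = λ a b i _ → +ℓ-comm (a i) (b i) } }

  private
    module ℤℓ = GroupProperties (AbelianGroup.group +ℓ-abelianGroup)
    module Rξ = AbelianGroup +ξ-abelianGroup
    module ℤℓ+ = CommutativeSemigroupProperties (AbelianGroup.commutativeSemigroup +ℓ-abelianGroup)
    module Rξ+ = CommutativeSemigroupProperties (AbelianGroup.commutativeSemigroup +ξ-abelianGroup)

    <⇒∸1< : ∀ {i n} → i < n → n ∸ 1 < n
    <⇒∸1< {n = suc n} _ = ≤-refl

    suc<⇒<∸1 : ∀ {i n} → suc i < n → i < n ∸ 1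
    suc<⇒<∸1 {n = suc n} (s≤s i<n) = i<n

  scale-cong : ∀ {r r' a b} → r ≈ℓ r' → a ≈ξ b → scale r a ≈ξ scale r' b
  scale-cong p q i i<d = *ℓ-cong p (q i i<d)

  scale-+ : ∀ r a b → scale r (a +ξ b) ≈ξ scale r a +ξ scale r b
  scale-+ r a b i _ = *ℓ-distribˡ r (a i) (b i)

  sumξ-cong : ∀ n {f g} → (∀ i → i < n → f i ≈ξ g i) → sumξ n f ≈ξ sumξ n g
  sumξ-cong zero    _   = Rξ.refl
  sumξ-cong (suc n) f≈g = Rξ.∙-cong (sumξ-cong n (λ i i<n → f≈g i (m<n⇒m<1+n i<n))) (f≈g n ≤-refl)

  sumξ-+ : ∀ n f g → sumξ n (λ i → f i +ξ g i) ≈ξ sumξ n f +ξ sumξ n g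
  sumξ-+ zero    f g = Rξ.sym (Rξ.identityˡ 0ξ)
  sumξ-+ (suc n) f g = Rξ.trans (Rξ.∙-congʳ (sumξ-+ n f g)) (Rξ+.interchange _ _ (f n) (g n))

  if-neg-cong : ∀ t {x y} → x ≈ℓ y → (if t then -ℓ x else 0ℓ) ≈ℓ (if t then -ℓ y else 0ℓ)
  if-neg-cong true  x≈y = -ℓ-cong x≈y
  if-neg-cong false x≈y = ≈ℓ-refl

  if-neg-+ : ∀ t x y →
    (if t then -ℓ (x +ℓ y) else 0ℓ) ≈ℓ (if t then -ℓ x else 0ℓ) +ℓ (if t then -ℓ y else 0ℓ)
  if-neg-+ true  x y = ≈ℓ-sym (AbelianGroupProperties.⁻¹-∙-comm +ℓ-abelianGroup x y)
  if-neg-+ false x y = ≈ℓ-sym (+ℓ-identityˡ 0ℓ)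

  mulξ-cong : ∀ {a b} → a ≈ξ b → mulξ a ≈ξ mulξ b
  mulξ-cong a≈b zero    i<d = +ℓ-cong ≈ℓ-refl (if-neg-cong (does (m ∣? 0)) (a≈b (d ∸ 1) (<⇒∸1< i<d)))
  mulξ-cong a≈b (suc j) i<d =
    +ℓ-cong (a≈b j (<-trans (n<1+n j) i<d)) (if-neg-cong (does (m ∣? suc j)) (a≈b (d ∸ 1) (<⇒∸1< i<d)))

  mulξ-+ : ∀ a b → mulξ (a +ξ b) ≈ξ mulξ a +ξ mulξ b
  mulξ-+ a b zero    _ = ≈ℓ-trans (+ℓ-cong (≈ℓ-sym (+ℓ-identityˡ 0ℓ)) (if-neg-+ (does (m ∣? 0)) _ _))
    (ℤℓ+.interchange _ _ _ _)
  mulξ-+ a b (suc j) _ = ≈ℓ-trans (+ℓ-cong ≈ℓ-refl (if-neg-+ (does (m ∣? suc j)) _ _))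
    (ℤℓ+.interchange _ _ _ _)

  mulξ^-cong : ∀ k {a b} → a ≈ξ b → mulξ^ k a ≈ξ mulξ^ k b
  mulξ^-cong zero    a≈b = a≈b
  mulξ^-cong (suc k) a≈b = mulξ-cong (mulξ^-cong k a≈b)

  mulξ^-+ : ∀ k a b → mulξ^ k (a +ξ b) ≈ξ mulξ^ k a +ξ mulξ^ k b
  mulξ^-+ zero    a b = Rξ.refl
  mulξ^-+ (suc k) a b = Rξ.trans (mulξ-cong (mulξ^-+ k a b)) (mulξ-+ _ _)

  *ξ-cong : ∀ {a a' b b'} → a ≈ξ a' → b ≈ξ b' → a *ξ b ≈ξ a' *ξ b'
  *ξ-cong p q = sumξ-cong d (λ i i<d → scale-cong (p i i<d) (mulξ^-cong i q))

  *ξ-distribˡ : ∀ a b c → a *ξ (b +ξ c) ≈ξ (a *ξ b) +ξ (a *ξ c)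
  *ξ-distribˡ a b c = Rξ.trans
    (sumξ-cong d (λ i _ → Rξ.trans (scale-cong ≈ℓ-refl (mulξ^-+ i b c)) (scale-+ (a i) _ _)))
    (sumξ-+ d _ _)

  *ξ-identityˡ : ∀ c → 1ξ *ξ c ≈ξ c
  *ξ-identityˡ c i i<d = ≈ℓ-trans (sum-first d (<⇒∸1< i<d)) (*ℓ-identityˡ (c i))
    where
    sum-first : ∀ n → n ∸ 1 < n → sumξ n (λ k → scale (1ξ k) (mulξ^ k c)) i ≈ℓ 1ℓ *ℓ c i
    sum-first (suc zero)    _ = +ℓ-identityˡ _
    sum-first (suc (suc n)) _ =
      ≈ℓ-trans (+ℓ-cong (sum-first (suc n) ≤-refl) (*ℓ-zeroˡ _)) (+ℓ-identityʳ _)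

  δ : ℕ → ℕ → ℤℓ
  δ i j = if does (i ≟ j) then 1ℓ else 0ℓ

  δ-diag : ∀ i → δ i i ≡ 1ℓ
  δ-diag i = cong (if_then 1ℓ else 0ℓ) (dec-true (i ≟ i) refl)

  δ-≢ : ∀ {i j} → i ≢ j → δ i j ≡ 0ℓ
  δ-≢ {i} {j} i≢j = cong (if_then 1ℓ else 0ℓ) (dec-false (i ≟ j) i≢j)

  ξ^-coordinate : ∀ i → i < d → ∀ j → j < d → (ξ^ i) j ≈ℓ δ i j

  -- for suc i < d the top coordinate of ξ^i vanishes, so multiplying it by ξ needs no reduction by Φ
  wraparound-vanishes : ∀ i → suc i < d → ∀ t → (if t then -ℓ ((ξ^ i) (d ∸ 1)) else 0ℓ) ≈ℓ 0ℓ
  wraparound-vanishes i i<d true  = ≈ℓ-trans (-ℓ-cong top≈0) ℤℓ.ε⁻¹≈ε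
    where
    top≈0 : (ξ^ i) (d ∸ 1) ≈ℓ 0ℓ
    top≈0 = ≈ℓ-trans (ξ^-coordinate i (<-trans (n<1+n i) i<d) (d ∸ 1) (<⇒∸1< i<d))
                     (≈ℓ-reflexive (δ-≢ (<⇒≢ (suc<⇒<∸1 i<d))))
  wraparound-vanishes i i<d false = ≈ℓ-refl

  ξ^-coordinate zero    _   zero    _ = ≈ℓ-refl
  ξ^-coordinate zero    _   (suc j) _ = ≈ℓ-refl
  ξ^-coordinate (suc i) i<d zero    _   =
    ≈ℓ-trans (+ℓ-cong ≈ℓ-refl (wraparound-vanishes i i<d (does (m ∣? 0)))) (+ℓ-identityʳ _)
  ξ^-coordinate (suc i) i<d (suc j) j<d = ≈ℓ-trans
    (+ℓ-cong (ξ^-coordinate i (<-trans (n<1+n i) i<d) j (<-trans (n<1+n j) j<d))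
             (wraparound-vanishes i i<d (does (m ∣? suc j))))
    (+ℓ-identityʳ _)

  *ξ-identityʳ : ∀ r → r *ξ 1ξ ≈ξ r
  *ξ-identityʳ r j j<d = proj₁ (partial-sum d ≤-refl) j<d
    where
    e : ℕ → Rξ
    e i = scale (r i) (ξ^ i)

    e-at : ∀ {n} → n < d → ∀ {u} → δ n j ≡ u → e n j ≈ℓ r n *ℓ u
    e-at n<d refl = *ℓ-cong ≈ℓ-refl (ξ^-coordinate _ n<d j j<d)

    off-diagonal : ∀ {n} → n < d → n ≢ j → e n j ≈ℓ 0ℓ
    off-diagonal {n} n<d n≢j = ≈ℓ-trans (e-at n<d (δ-≢ n≢j)) (*ℓ-zeroʳ (r n))

    on-diagonal : j < d → e j j ≈ℓ r j
    on-diagonal j<d = ≈ℓ-trans (e-at j<d (δ-diag j)) (*ℓ-identityʳ (r j))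

    partial-sum : ∀ n → n ≤ d → (j < n → sumξ n e j ≈ℓ r j) × (n ≤ j → sumξ n e j ≈ℓ 0ℓ)
    partial-sum zero    _   = (λ ()) , (λ _ → ≈ℓ-refl)
    partial-sum (suc n) n<d with partial-sum n (<⇒≤ n<d) | <-cmp j n
    ... | below , _ | tri< j<n j≢n _ =
      (λ _ → ≈ℓ-trans (+ℓ-cong (below j<n) (off-diagonal n<d (j≢n ∘ sym))) (+ℓ-identityʳ _)) ,
      (λ n<j → ⊥-elim (<-asym j<n n<j))
    ... | _ , above | tri≈ _ refl _ =
      (λ _ → ≈ℓ-trans (+ℓ-cong (above ≤-refl) (on-diagonal n<d)) (+ℓ-identityˡ _)) ,
      (λ n<n → ⊥-elim (<-irrefl refl n<n))
    ... | _ , above | tri> _ j≢n n<j =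
      (λ j<1+n → ⊥-elim (<⇒≱ n<j (s≤s⁻¹ j<1+n))) ,
      (λ _ → ≈ℓ-trans (+ℓ-cong (above (<⇒≤ n<j)) (off-diagonal n<d (j≢n ∘ sym))) (+ℓ-identityʳ _))

  *ξ-zeroʳ : ∀ a → a *ξ 0ξ ≈ξ 0ξ
  *ξ-zeroʳ a = GroupProperties.identityˡ-unique (AbelianGroup.group +ξ-abelianGroup) (a *ξ 0ξ) (a *ξ 0ξ)
    (Rξ.trans (Rξ.sym (*ξ-distribˡ a 0ξ 0ξ)) (*ξ-cong Rξ.refl (Rξ.identityˡ 0ξ)))

card≤ : ∀ {n} (U : Fin n → Bool) → card U ≤ n
card≤ {zero}  U = z≤n
card≤ {suc n} U with U fzero
... | true  = s≤s (card≤ (λ s → U (fsuc s)))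
... | false = m≤n⇒m≤1+n (card≤ (λ s → U (fsuc s)))

allFin-suc : ∀ k → allFin (suc k) ≡ fzero ∷ map fsuc (allFin k)
allFin-suc k = ≡.cong (fzero ∷_) (≡.sym (map-tabulate (λ i → i) fsuc))

module ListSum {c r} (G : AbelianGroup c r) where
  open AbelianGroup G
  open CommutativeSemigroupProperties commutativeSemigroup using (interchange)

  ∑ : {X : Set} → List X → (X → Carrier) → Carrier
  ∑ xs f = foldr (λ x acc → f x ∙ acc) ε xs

  select : Bool → Carrier → Carrier
  select b u = if b then u else ε

  select-cong : ∀ b {u v} → u ≈ v → select b u ≈ select b v
  select-cong true  u≈v = u≈v
  select-cong false _   = refl

  select-∙ : ∀ b u v → select b (u ∙ v) ≈ select b u ∙ select b v
  select-∙ true  u v = refl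
  select-∙ false u v = sym (identityˡ ε)

  module _ {X : Set} where

    ∑-cong : ∀ (xs : List X) {f g} → (∀ x → f x ≈ g x) → ∑ xs f ≈ ∑ xs g
    ∑-cong []       _   = refl
    ∑-cong (x ∷ xs) f≈g = ∙-cong (f≈g x) (∑-cong xs f≈g)

    ∑-ε : ∀ (xs : List X) {f} → (∀ x → f x ≈ ε) → ∑ xs f ≈ ε
    ∑-ε []       _   = refl
    ∑-ε (x ∷ xs) f≈ε = trans (∙-cong (f≈ε x) (∑-ε xs f≈ε)) (identityˡ ε)

    ∑-∙ : ∀ (xs : List X) f g → ∑ xs (λ x → f x ∙ g x) ≈ ∑ xs f ∙ ∑ xs g
    ∑-∙ []       f g = sym (identityˡ ε)
    ∑-∙ (x ∷ xs) f g = trans (∙-congˡ (∑-∙ xs f g)) (interchange (f x) (g x) _ _)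

    ∑-++ : ∀ (xs ys : List X) f → ∑ (xs ++ ys) f ≈ ∑ xs f ∙ ∑ ys f
    ∑-++ []       ys f = sym (identityˡ _)
    ∑-++ (x ∷ xs) ys f = trans (∙-congˡ (∑-++ xs ys f)) (sym (assoc (f x) _ _))

  module _ {X Y : Set} where

    ∑-map : ∀ (g : X → Y) (xs : List X) f → ∑ (map g xs) f ≈ ∑ xs (λ x → f (g x))
    ∑-map g []       f = refl
    ∑-map g (x ∷ xs) f = ∙-congˡ (∑-map g xs f)

    ∑-concatMap : ∀ (g : X → List Y) (xs : List X) f → ∑ (concatMap g xs) f ≈ ∑ xs (λ x → ∑ (g x) f)
    ∑-concatMap g []       f = refl
    ∑-concatMap g (x ∷ xs) f = trans (∑-++ (g x) (concatMap g xs) f) (∙-congˡ (∑-concatMap g xs f))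

    ∑-swap : ∀ (xs : List X) (ys : List Y) (f : X → Y → Carrier) →
             ∑ xs (λ x → ∑ ys (λ y → f x y)) ≈ ∑ ys (λ y → ∑ xs (λ x → f x y))
    ∑-swap []       ys f = sym (∑-ε ys (λ _ → refl))
    ∑-swap (x ∷ xs) ys f = trans (∙-congˡ (∑-swap xs ys f)) (sym (∑-∙ ys (f x) _))

  ∑-allFin-single : ∀ k (z : Fin k) f → (∀ i → i ≢ z → f i ≈ ε) → ∑ (allFin k) f ≈ f z
  ∑-allFin-single (suc k) z f off = begin
    ∑ (allFin (suc k)) f                        ≡⟨ ≡.cong (λ is → ∑ is f) (allFin-suc k) ⟩
    f fzero ∙ ∑ (map fsuc (allFin k)) f         ≈⟨ ∙-congˡ (∑-map fsuc (allFin k) f) ⟩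
    f fzero ∙ ∑ (allFin k) (λ i → f (fsuc i))   ≈⟨ split z off ⟩
    f z                                         ∎
    where
    open SetoidReasoning setoid
    split : ∀ z → (∀ i → i ≢ z → f i ≈ ε) → f fzero ∙ ∑ (allFin k) (λ i → f (fsuc i)) ≈ f z
    split fzero    off = trans (∙-congˡ (∑-ε (allFin k) (λ i → off (fsuc i) λ ()))) (identityʳ _)
    split (fsuc z) off = trans (∙-congʳ (off fzero λ ())) (trans (identityˡ _)
      (∑-allFin-single k z (λ i → f (fsuc i)) λ i i≢z → off (fsuc i) (i≢z ∘ Fin.suc-injective)))

  ∑-allPoints-single : ∀ n sz (z : Point n sz) f →
                       (∀ x → x ≢ z → f x ≈ ε) → ∑ (allPoints n sz) f ≈ f z
  ∑-allPoints-single zero    sz z          f off = identityʳ _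
  ∑-allPoints-single (suc n) sz (z₁ , z₂) f off = begin
    ∑ (allPoints (suc n) sz) f                           ≈⟨ ∑-concatMap (λ i → map (i ,_) points) is f ⟩
    ∑ is (λ i → ∑ (map (i ,_) points) f)                 ≈⟨ ∑-cong is (λ i → ∑-map (i ,_) points f) ⟩
    ∑ is (λ i → ∑ points (λ p → f (i , p)))              ≈⟨ ∑-allFin-single (sz fzero) z₁ _ off-z₁ ⟩
    ∑ points (λ p → f (z₁ , p))                          ≈⟨ ∑-allPoints-single n _ z₂ (λ p → f (z₁ , p)) off-z₂ ⟩
    f (z₁ , z₂)                                          ∎
    where
    open SetoidReasoning setoid
    is = allFin (sz fzero)
    points = allPoints n (λ s → sz (fsuc s))
    off-z₁ : ∀ i → i ≢ z₁ → ∑ points (λ p → f (i , p)) ≈ ε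
    off-z₁ i i≢z₁ = ∑-ε points (λ p → off (i , p) (λ eq → i≢z₁ (≡.cong proj₁ eq)))
    off-z₂ : ∀ p → p ≢ z₂ → f (z₁ , p) ≈ ε
    off-z₂ p p≢z₂ = off (z₁ , p) (λ eq → p≢z₂ (≡.cong proj₂ eq))

  ∑-allSubsets-full : ∀ n u → ∑ (allSubsets n) (λ U → select (card U ≡ᵇ n) u) ≈ u
  ∑-allSubsets-full zero    u = identityʳ u
  ∑-allSubsets-full (suc n) u =
    trans (∑-++ (map _ subsets) _ _)
          (trans (∙-cong with-s (trans (∑-++ (map _ subsets) [] _) without-s)) (identityʳ u))
    where
    subsets = allSubsets n
    with-s : ∑ (map _ subsets) (λ U → select (card U ≡ᵇ suc n) u) ≈ u
    with-s = trans (∑-map _ subsets _) (∑-allSubsets-full n u)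
    not-full : ∀ U → select (card U ≡ᵇ suc n) u ≈ ε
    not-full U = reflexive (≡.cong (λ b → select b u)
                                   (dec-false (card U ≟ suc n) (λ eq → <-irrefl eq (s≤s (card≤ U)))))
    without-s : ∑ (map _ subsets) (λ U → select (card U ≡ᵇ suc n) u) ∙ ε ≈ ε
    without-s = trans (identityʳ _) (trans (∑-map _ subsets _) (∑-ε subsets not-full))

module GroupHomomorphism {c₁ r₁ c₂ r₂} (G : AbelianGroup c₁ r₁) (H : AbelianGroup c₂ r₂)
  (h : AbelianGroup.Carrier G → AbelianGroup.Carrier H)
  (h-cong : ∀ {x y} → AbelianGroup._≈_ G x y → AbelianGroup._≈_ H (h x) (h y))
  (h-∙ : ∀ x y → AbelianGroup._≈_ H (h (AbelianGroup._∙_ G x y)) (AbelianGroup._∙_ H (h x) (h y)))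
  where
  private
    module G = AbelianGroup G
    module H = AbelianGroup H
    module ∑G = ListSum G
    module ∑H = ListSum H

  h-ε : h G.ε H.≈ H.ε
  h-ε = GroupProperties.identityˡ-unique H.group (h G.ε) (h G.ε)
    (H.trans (H.sym (h-∙ G.ε G.ε)) (h-cong (G.identityˡ G.ε)))

  h-⁻¹ : ∀ x → h (x G.⁻¹) H.≈ h x H.⁻¹
  h-⁻¹ x = GroupProperties.inverseʳ-unique H.group (h x) (h (x G.⁻¹))
    (H.trans (H.sym (h-∙ x (x G.⁻¹))) (H.trans (h-cong (G.inverseʳ x)) h-ε))

  h-∑ : ∀ {X : Set} (xs : List X) f → h (∑G.∑ xs f) H.≈ ∑H.∑ xs (λ x → h (f x))
  h-∑ []       f = h-ε
  h-∑ (x ∷ xs) f = H.trans (h-∙ (f x) _) (H.∙-congˡ (h-∑ xs f))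

  h-select : ∀ b u → h (∑G.select b u) H.≈ ∑H.select b (h u)
  h-select true  u = H.refl
  h-select false u = h-ε

_≟ₚ_ : ∀ {n sz} → DecidableEquality (Point n sz)
_≟ₚ_ {zero}  _ _ = yes ≡.refl
_≟ₚ_ {suc n} = ≡-dec Fin._≟_ _≟ₚ_

module ClosureProjection (ℓ : ℕ) .{{_ : NonZero ℓ}} (k0 nS : ℕ) (sz : Fin nS → ℕ)
       {g h c r : Level} {G : Group g h} {A : AbelianGroup c r} (M : Coeffs.ModGξ ℓ k0 G A) where
  open Coeffs ℓ k0
  open ℤℓ[ξ]-Properties ℓ k0
    using (+ξ-abelianGroup; *ξ-cong; *ξ-distribˡ; *ξ-identityˡ; *ξ-identityʳ; *ξ-zeroʳ)
  open Grid nS sz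
  open OverN M
  open ModGξ M
  open ≡ using (refl)

  private
    module Rξ where
      open AbelianGroup +ξ-abelianGroup public
      open ListSum +ξ-abelianGroup public
      open GroupProperties group public using (ε⁻¹≈ε)
      open AbelianGroupProperties +ξ-abelianGroup public using (⁻¹-anti-homo‿-; xyx⁻¹≈y; ⁻¹-∙-comm)
    module N where
      open AbelianGroup A public
      open ListSum A public
      open GroupProperties group public using (x∙y⁻¹≈ε⇒x≈y)
      open AbelianGroupProperties A public using (⁻¹-∙-comm)

    module ScaleBy (a : Rξ) = GroupHomomorphism A A (a •_) (•-cong Rξ.refl) (•-distribˡ a)
    module ActOn (y : N.Carrier) =
      GroupHomomorphism +ξ-abelianGroup A (_• y) (λ p → •-cong p N.refl) (λ a b → •-distribʳ a b y)
    module MultiplyBy (b : Rξ) =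
      GroupHomomorphism +ξ-abelianGroup +ξ-abelianGroup (b *ξ_) (*ξ-cong Rξ.refl) (*ξ-distribˡ b)
    module SelectRξ (t : Bool) =
      GroupHomomorphism +ξ-abelianGroup +ξ-abelianGroup (Rξ.select t) (Rξ.select-cong t) (Rξ.select-∙ t)
    module NegateRξ =
      GroupHomomorphism +ξ-abelianGroup +ξ-abelianGroup -ξ_ Rξ.⁻¹-cong (λ a b → Rξ.sym (Rξ.⁻¹-∙-comm a b))
    module NegateN = GroupHomomorphism A A N._⁻¹ N.⁻¹-cong (λ x y → N.sym (N.⁻¹-∙-comm x y))

  points : List X
  points = allPoints nS sz

  δₚ : X → X → Rξ
  δₚ z x = if does (z ≟ₚ x) then 1ξ else 0ξ

  δₚ-diag : ∀ z → δₚ z z ≡ 1ξ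
  δₚ-diag z = ≡.cong (if_then 1ξ else 0ξ) (dec-true (z ≟ₚ z) refl)

  δₚ-≢ : ∀ {z x} → z ≢ x → δₚ z x ≡ 0ξ
  δₚ-≢ {z} {x} z≢x = ≡.cong (if_then 1ξ else 0ξ) (dec-false (z ≟ₚ x) z≢x)

  restrict : SubX → (X → Rξ) → X → Rξ
  restrict Z a x = if Z x then a x else 0ξ

  ZeroLineSums : (X → Rξ) → Set
  ZeroLineSums a = ∀ s x0 → lineSum s x0 a ≈ξ 0ξ

  lineSum-+ : ∀ s x0 a b → lineSum s x0 (λ x → a x +ξ b x) ≈ξ lineSum s x0 a +ξ lineSum s x0 b
  lineSum-+ s x0 a b =
    Rξ.trans (Rξ.∑-cong points (λ x → Rξ.select-∙ (sameExcept s x0 x) (a x) (b x))) (Rξ.∑-∙ points _ _)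

  lineSum-neg : ∀ s x0 a → lineSum s x0 (λ x → -ξ a x) ≈ξ -ξ lineSum s x0 a
  lineSum-neg s x0 a = Rξ.trans (Rξ.∑-cong points (λ x → SelectRξ.h-⁻¹ (sameExcept s x0 x) (a x)))
                                (Rξ.sym (NegateRξ.h-∑ points _))

  lineSum-combination : ∀ {Z : Set} (zs : List Z) (b : Z → Rξ) (a : Z → X → Rξ) s x0 →
    lineSum s x0 (λ x → Rξ.∑ zs (λ z → b z *ξ a z x)) ≈ξ Rξ.∑ zs (λ z → b z *ξ lineSum s x0 (a z))
  lineSum-combination zs b a s x0 = begin
    Rξ.∑ points (λ x → select x (Rξ.∑ zs (λ z → b z *ξ a z x)))   ≈⟨ Rξ.∑-cong points (λ x → SelectRξ.h-∑ (on x) zs _) ⟩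
    Rξ.∑ points (λ x → Rξ.∑ zs (λ z → select x (b z *ξ a z x)))   ≈⟨ Rξ.∑-swap points zs _ ⟩
    Rξ.∑ zs (λ z → Rξ.∑ points (λ x → select x (b z *ξ a z x)))   ≈⟨ Rξ.∑-cong zs (λ z → Rξ.∑-cong points λ x →
                                                                        MultiplyBy.h-select (b z) (on x) (a z x)) ⟨
    Rξ.∑ zs (λ z → Rξ.∑ points (λ x → b z *ξ select x (a z x)))   ≈⟨ Rξ.∑-cong zs (λ z → MultiplyBy.h-∑ (b z) points _) ⟨
    Rξ.∑ zs (λ z → b z *ξ lineSum s x0 (a z))                      ∎
    where
    open SetoidReasoning Rξ.setoid
    on : X → Bool
    on = sameExcept s x0
    select : X → Rξ → Rξ
    select x = Rξ.select (on x)

  zeroLineSums-neg : ∀ {a} → ZeroLineSums a → ZeroLineSums (λ x → -ξ a x)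
  zeroLineSums-neg {a} za s x0 = Rξ.trans (lineSum-neg s x0 a) (Rξ.trans (Rξ.⁻¹-cong (za s x0)) Rξ.ε⁻¹≈ε)

  zeroLineSums-combination : ∀ {Z : Set} (zs : List Z) (b : Z → Rξ) {a : Z → X → Rξ} →
    (∀ z → ZeroLineSums (a z)) → ZeroLineSums (λ x → Rξ.∑ zs (λ z → b z *ξ a z x))
  zeroLineSums-combination zs b {a} za s x0 = Rξ.trans (lineSum-combination zs b a s x0)
    (Rξ.∑-ε zs (λ z → Rξ.trans (*ξ-cong Rξ.refl (za z s x0)) (*ξ-zeroʳ (b z))))

  Spanned : (X → Rξ) → Set
  Spanned a = Σ ((Fin nS → Bool) → X → Rξ) λ c →
    (∀ U → 𝒫S U ≡ true → zs U (λ _ → true) (c U)) ×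
    (∀ x → a x ≈ξ sumList (allSubsets nS) (λ U → if 𝒫S U then (ω^ (nS ∸ card U)) *ξ c U x else 0ξ))

  spanned-cong : ∀ {a a'} → (∀ x → a x ≈ξ a' x) → Spanned a → Spanned a'
  spanned-cong a≈a' (c , zs-c , a≈) = c , zs-c , λ x → Rξ.trans (Rξ.sym (a≈a' x)) (a≈ x)

  spanned-+ : ∀ {a b} → Spanned a → Spanned b → Spanned (λ x → a x +ξ b x)
  spanned-+ {a} {b} (c , zs-c , a≈) (c' , zs-c' , b≈) = (λ U x → c U x +ξ c' U x) , zs-sum , sum≈
    where
    zs-sum : ∀ U → 𝒫S U ≡ true → zs U (λ _ → true) (λ x → c U x +ξ c' U x)
    zs-sum U _ = (λ _ ()) , λ s Us x0 → Rξ.trans (lineSum-+ s x0 (c U) (c' U))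
      (Rξ.trans (Rξ.∙-cong (proj₂ (zs-c U refl) s Us x0) (proj₂ (zs-c' U refl) s Us x0)) (Rξ.identityˡ 0ξ))
    sum≈ : ∀ x → a x +ξ b x ≈ξ Rξ.∑ (allSubsets nS) (λ U → (ω^ (nS ∸ card U)) *ξ (c U x +ξ c' U x))
    sum≈ x = Rξ.trans (Rξ.∙-cong (a≈ x) (b≈ x)) (Rξ.trans (Rξ.sym (Rξ.∑-∙ (allSubsets nS) _ _))
      (Rξ.∑-cong (allSubsets nS) (λ U → Rξ.sym (*ξ-distribˡ _ (c U x) (c' U x)))))

  -- a lies in the U = S summand, whose weight is ω^0 = 1
  zeroLineSums⇒spanned : ∀ {a} → ZeroLineSums a → Spanned a
  zeroLineSums⇒spanned {a} za = (λ U x → Rξ.select (full? U) (a x)) , zs-c , a≈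
    where
    full? : (Fin nS → Bool) → Bool
    full? U = card U ≡ᵇ nS

    zs-c : ∀ U → 𝒫S U ≡ true → zs U (λ _ → true) (λ x → Rξ.select (full? U) (a x))
    zs-c U _ = (λ _ ()) , λ s _ x0 → selected (full? U) s x0
      where
      selected : ∀ t s x0 → lineSum s x0 (λ x → Rξ.select t (a x)) ≈ξ 0ξ
      selected true  s x0 = za s x0
      selected false s x0 = Rξ.∑-ε points (λ x → SelectRξ.h-ε (sameExcept s x0 x))

    weighted : ∀ x U → (ω^ (nS ∸ card U)) *ξ Rξ.select (full? U) (a x) ≈ξ Rξ.select (full? U) (a x)
    weighted x U with card U ≡ᵇ nS in eq
    ... | true rewrite ≡ᵇ⇒≡ (card U) nS (≡.subst T (≡.sym eq) _) | n∸n≡0 nS = *ξ-identityˡ _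
    ... | false = *ξ-zeroʳ _

    a≈ : ∀ x → a x ≈ξ Rξ.∑ (allSubsets nS) (λ U → (ω^ (nS ∸ card U)) *ξ Rξ.select (full? U) (a x))
    a≈ x = Rξ.sym (Rξ.trans (Rξ.∑-cong (allSubsets nS) (weighted x)) (Rξ.∑-allSubsets-full nS (a x)))

  zs⊆zsIb : ∀ {Z a} → zs full Z a → zsIb 𝒫S nS Z a
  zs⊆zsIb (supp , lines) = supp , zeroLineSums⇒spanned (λ s → lines s refl)

  restrict-off : ∀ Z a {x} → Z x ≡ false → restrict Z a x ≡ 0ξ
  restrict-off Z a Zx rewrite Zx = refl

  dot-cong-on : ∀ Z {a n n'} → Supp Z a → (∀ x → Z x ≡ true → n x N.≈ n' x) → dot a n N.≈ dot a n'
  dot-cong-on Z {a} {n} {n'} supp n≈n' = N.∑-cong points term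
    where
    vanishes : ∀ {x} → Z x ≡ false → ∀ m → a x • m N.≈ N.ε
    vanishes Zx m = N.trans (•-cong (supp _ Zx) N.refl) (ActOn.h-ε m)
    term : ∀ x → a x • n x N.≈ a x • n' x
    term x with Z x in Zx
    ... | true  = •-cong Rξ.refl (n≈n' x Zx)
    ... | false = N.trans (vanishes Zx (n x)) (N.sym (vanishes Zx (n' x)))

  dot-restrict : ∀ Z a {n} → SuppN Z n → dot (restrict Z a) n N.≈ dot a n
  dot-restrict Z a {n} suppN = N.∑-cong points term
    where
    term : ∀ x → restrict Z a x • n x N.≈ a x • n x
    term x with Z x in Zx
    ... | true  = N.refl
    ... | false = N.trans (ActOn.h-ε (n x)) (N.sym (N.trans (•-cong Rξ.refl (suppN x Zx)) (ScaleBy.h-ε (a x))))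

  dot-sub : ∀ a b n → dot (λ x → a x -ξ b x) n N.≈ dot a n N.∙ dot b n N.⁻¹
  dot-sub a b n = N.trans
    (N.∑-cong points λ x → N.trans (•-distribʳ (a x) (-ξ b x) (n x)) (N.∙-congˡ (ActOn.h-⁻¹ (n x) (b x))))
    (N.trans (N.∑-∙ points _ _) (N.∙-congˡ (N.sym (NegateN.h-∑ points _))))

  dot-δₚ : ∀ z n → dot (δₚ z) n N.≈ n z
  dot-δₚ z n = N.trans (N.∑-allPoints-single nS sz z _ off)
                       (N.trans (•-cong (Rξ.reflexive (δₚ-diag z)) N.refl) (•-identity (n z)))
    where
    off : ∀ x → x ≢ z → δₚ z x • n x N.≈ N.ε
    off x x≢z = N.trans (•-cong (Rξ.reflexive (δₚ-≢ (≡.≢-sym x≢z))) N.refl) (ActOn.h-ε (n x))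

  dot-combination : ∀ {Z : Set} (zs : List Z) (b : Z → Rξ) (a : Z → X → Rξ) n →
    dot (λ x → Rξ.∑ zs (λ z → b z *ξ a z x)) n N.≈ N.∑ zs (λ z → b z • dot (a z) n)
  dot-combination zs b a n =
    N.trans (N.∑-cong points (λ x → ActOn.h-∑ (n x) zs _))
    (N.trans (N.∑-swap points zs _)
             (N.∑-cong zs (λ z → N.trans (N.∑-cong points (λ x → •-assoc (b z) (a z x) (n x)))
                                         (N.sym (ScaleBy.h-∑ (b z) points _)))))

  dot-cong-mod-zs : ∀ {Z n e a} → NIb 𝒫S nS Z n → zs full Z (λ x → e x -ξ a x) → dot e n N.≈ dot a n
  dot-cong-mod-zs {n = n} {e} {a} (_ , orthogonal) e-a∈zs =
    N.x∙y⁻¹≈ε⇒x≈y _ _ (N.trans (N.sym (dot-sub e a n)) (orthogonal _ (zs⊆zsIb e-a∈zs)))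

  module _ (Y Ybar : SubX) (closure : IsClosure Y Ybar) where

    private
      true≢false : true ≢ false
      true≢false ()

    Y⊆Ybar : Y ⊆ Ybar
    Y⊆Ybar = proj₁ closure

    ∉Ybar⇒∉Y : ∀ {x} → Ybar x ≡ false → Y x ≡ false
    ∉Ybar⇒∉Y {x} Ybarx with Y x in Yx
    ... | true  = ⊥-elim (true≢false (≡.trans (≡.sym (Y⊆Ybar x Yx)) Ybarx))
    ... | false = refl

    e : X → X → Rξ
    e z = restrict Ybar (δₚ z)

    representative : ∀ z → ∃ λ a → Supp Y a × zs full Ybar (λ x → e z x -ξ a x)
    representative z = proj₁ (proj₂ closure) (e z) λ x Ybarx → Rξ.reflexive (restrict-off Ybar (δₚ z) Ybarx)

    rep : X → X → Rξ
    rep z = proj₁ (representative z)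

    rep-supp : ∀ z → Supp Y (rep z)
    rep-supp z = proj₁ (proj₂ (representative z))

    e-rep∈zs : ∀ z → zs full Ybar (λ x → e z x -ξ rep z x)
    e-rep∈zs z = proj₂ (proj₂ (representative z))

    dot-e : ∀ {n} → SuppN Ybar n → ∀ z → dot (e z) n N.≈ n z
    dot-e suppN z = N.trans (dot-restrict Ybar (δₚ z) suppN) (dot-δₚ z _)

    dot-rep-Ybar : ∀ {n} → NIb 𝒫S nS Ybar n → ∀ z → dot (rep z) n N.≈ n z
    dot-rep-Ybar hn z = N.trans (N.sym (dot-cong-mod-zs hn (e-rep∈zs z))) (dot-e (proj₁ hn) z)

    -- off Ybar ∖ Y, e z - rep z is already supported on Y
    dot-rep-Y : ∀ {n} → NIb 𝒫S nS Y n → ∀ z → Y z ≡ true ⊎ Ybar z ≡ false → dot (rep z) n N.≈ n z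
    dot-rep-Y {n} hn z z∉Ybar∖Y =
      N.trans (N.sym (dot-cong-mod-zs hn (e-rep-supp , proj₂ (e-rep∈zs z)))) (dot-e suppN z)
      where
      suppN : SuppN Ybar n
      suppN x Ybarx = proj₁ hn x (∉Ybar⇒∉Y Ybarx)

      z≢ : ∀ {x} → Y z ≡ true ⊎ Ybar z ≡ false → Y x ≡ false → Ybar x ≡ true → z ≢ x
      z≢ (inj₁ Yz)    Yx _     refl = true≢false (≡.trans (≡.sym Yz) Yx)
      z≢ (inj₂ Ybarz) _  Ybarx refl = true≢false (≡.trans (≡.sym Ybarx) Ybarz)

      e-off : ∀ x → Y x ≡ false → e z x ≈ξ 0ξ
      e-off x Yx with Ybar x in Ybarx
      ... | true  = Rξ.reflexive (δₚ-≢ (z≢ z∉Ybar∖Y Yx Ybarx))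
      ... | false = Rξ.refl

      e-rep-supp : Supp Y (λ x → e z x -ξ rep z x)
      e-rep-supp x Yx = Rξ.trans (Rξ.∙-cong (e-off x Yx) (Rξ.⁻¹-cong (rep-supp z x Yx)))
                                 (Rξ.trans (Rξ.∙-congˡ Rξ.ε⁻¹≈ε) (Rξ.identityˡ 0ξ))

    ext : (X → N.Carrier) → X → N.Carrier
    ext n z = dot (rep z) n

    transfer : (X → Rξ) → X → Rξ
    transfer b x = Rξ.∑ points (λ z → b z *ξ rep z x)

    dot-ext : ∀ b n → dot b (ext n) N.≈ dot (transfer b) n
    dot-ext b n = N.sym (dot-combination points b rep n)

    transfer-zsIb : ∀ {b} → zsIb 𝒫S nS Ybar b → zsIb 𝒫S nS Y (transfer b)
    transfer-zsIb {b} (supp , spanned) =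
      supp-Y , spanned-cong b-Δ≈t (spanned-+ spanned (zeroLineSums⇒spanned (zeroLineSums-neg Δ-lines)))
      where
      t = transfer b

      Δ : X → Rξ
      Δ x = Rξ.∑ points (λ z → b z *ξ (e z x -ξ rep z x))

      Δ-lines : ZeroLineSums Δ
      Δ-lines = zeroLineSums-combination points b (λ z s x0 → proj₂ (e-rep∈zs z) s refl x0)

      supp-Y : Supp Y t
      supp-Y x Yx = Rξ.∑-ε points (λ z → Rξ.trans (*ξ-cong Rξ.refl (rep-supp z x Yx)) (*ξ-zeroʳ (b z)))

      b∘e≈b : ∀ x → Rξ.∑ points (λ z → b z *ξ e z x) ≈ξ b x
      b∘e≈b x with Ybar x in Ybarx
      ... | true  = Rξ.trans (Rξ.∑-allPoints-single nS sz x _ off) (*ξ-identityʳ' (b x))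
        where
        off : ∀ z → z ≢ x → b z *ξ δₚ z x ≈ξ 0ξ
        off z z≢x = Rξ.trans (*ξ-cong Rξ.refl (Rξ.reflexive (δₚ-≢ z≢x))) (*ξ-zeroʳ (b z))
        *ξ-identityʳ' : ∀ u → u *ξ δₚ x x ≈ξ u
        *ξ-identityʳ' u = Rξ.trans (*ξ-cong Rξ.refl (Rξ.reflexive (δₚ-diag x))) (*ξ-identityʳ u)
      ... | false = Rξ.trans (Rξ.∑-ε points (λ z → *ξ-zeroʳ (b z))) (Rξ.sym (supp x Ybarx))

      Δ≈b-t : ∀ x → Δ x ≈ξ b x -ξ t x
      Δ≈b-t x = Rξ.trans
        (Rξ.∑-cong points λ z → Rξ.trans (*ξ-distribˡ (b z) _ _) (Rξ.∙-congˡ (MultiplyBy.h-⁻¹ (b z) (rep z x))))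
        (Rξ.trans (Rξ.∑-∙ points _ _) (Rξ.∙-cong (b∘e≈b x) (Rξ.sym (NegateRξ.h-∑ points _))))

      b-Δ≈t : ∀ x → b x +ξ (-ξ Δ x) ≈ξ t x
      b-Δ≈t x = Rξ.trans (Rξ.∙-congˡ (Rξ.trans (Rξ.⁻¹-cong (Δ≈b-t x)) (Rξ.⁻¹-anti-homo‿- (b x) (t x))))
                (Rξ.trans (Rξ.sym (Rξ.assoc (b x) (t x) _)) (Rξ.xyx⁻¹≈y (b x) (t x)))

    proj-on : ∀ n {x} → Y x ≡ true → proj Y n x ≡ n x
    proj-on n Yx rewrite Yx = refl

    proj-off : ∀ n {x} → Y x ≡ false → proj Y n x ≡ N.ε
    proj-off n Yx rewrite Yx = refl

    proj-maps : ∀ n → NIb 𝒫S nS Ybar n → NIb 𝒫S nS Y (proj Y n)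
    proj-maps n (_ , orthogonal) = (λ x Yx → N.reflexive (proj-off n Yx)) , λ a (supp , spanned) →
      N.trans (dot-cong-on Y supp (λ x Yx → N.reflexive (proj-on n Yx)))
              (orthogonal a ((λ x Ybarx → supp x (∉Ybar⇒∉Y Ybarx)) , spanned))

    proj-injective : ∀ n n' → NIb 𝒫S nS Ybar n → NIb 𝒫S nS Ybar n' →
                     (∀ x → proj Y n x N.≈ proj Y n' x) → ∀ x → n x N.≈ n' x
    proj-injective n n' hn hn' agree z =
      N.trans (N.sym (dot-rep-Ybar hn z)) (N.trans (dot-cong-on Y (rep-supp z) agree-on-Y) (dot-rep-Ybar hn' z))
      where
      agree-on-Y : ∀ x → Y x ≡ true → n x N.≈ n' x
      agree-on-Y x Yx =
        N.trans (N.reflexive (≡.sym (proj-on n Yx))) (N.trans (agree x) (N.reflexive (proj-on n' Yx)))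

    proj-surjective : ∀ n → NIb 𝒫S nS Y n → ∃ λ n' → NIb 𝒫S nS Ybar n' × (∀ x → proj Y n' x N.≈ n x)
    proj-surjective n hn = ext n , (ext-supp , ext-orthogonal) , ext-proj
      where
      ext-supp : SuppN Ybar (ext n)
      ext-supp z Ybarz = N.trans (dot-rep-Y hn z (inj₂ Ybarz)) (proj₁ hn z (∉Ybar⇒∉Y Ybarz))

      ext-orthogonal : ∀ b → zsIb 𝒫S nS Ybar b → dot b (ext n) N.≈ N.ε
      ext-orthogonal b hb = N.trans (dot-ext b n) (proj₂ hn _ (transfer-zsIb hb))

      ext-proj : ∀ x → proj Y (ext n) x N.≈ n x
      ext-proj x with Y x in Yx
      ... | true  = dot-rep-Y hn x (inj₁ Yx)
      ... | false = N.sym (proj₁ hn x Yx)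

    proj-bijective : ProjBij (NIb 𝒫S nS Ybar) (NIb 𝒫S nS Y) Y
    proj-bijective = proj-maps , proj-injective , proj-surjective

proposition7p12 :
  (ℓ : ℕ) .{{_ : NonZero ℓ}} → Prime ℓ → (k0 : ℕ) → 1 ≤ k0 →
  (nS : ℕ) → 1 ≤ nS → (sz : Fin nS → ℕ) → (∀ s → 1 ≤ sz s) →
  {g h c r : Level} (G : Group g h) (A : AbelianGroup c r) →
  (M : Coeffs.ModGξ ℓ k0 G A) →
  (χ0 : Coeffs.Char ℓ k0 G) →
  (χs : (s : Fin nS) → Fin (sz s) → Coeffs.Char ℓ k0 G) →
  Coeffs.Divisible ℓ k0 M →
  (Y Ybar : Coeffs.Grid.SubX ℓ k0 nS sz) →
  Coeffs.Grid.IsClosure ℓ k0 nS sz Y Ybar →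
  Coeffs.Grid.OverN.ProjBij ℓ k0 nS sz M
    (Coeffs.Grid.OverN.NIb ℓ k0 nS sz M (Coeffs.Grid.𝒫S ℓ k0 nS sz) nS Ybar)
    (Coeffs.Grid.OverN.NIb ℓ k0 nS sz M (Coeffs.Grid.𝒫S ℓ k0 nS sz) nS Y)
    Y
proposition7p12 ℓ _ k0 _ nS _ sz _ G A M _ _ _ Y Ybar closure =
  ClosureProjection.proj-bijective ℓ k0 nS sz M Y Ybar closure
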